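{- Let $(G,(A,B,S))$ be a nice structured pair. Then there do not exist three distinct vertices $x,y,z\in S$ with $xy,yz\notin E(G)$ and $N_A(x)\subsetneq N_A(y)\subsetneq N_A(z)$; likewise there do not exist three distinct vertices $x,y,z\in S$ with $xy,yz\notin E(G)$ and $N_B(x)\subsetneq N_B(y)\subsetneq N_B(z)$.
   Context: All graphs are finite and simple. $N(X)$ is the set of vertices outside $X$ with a neighbour in $X$, $N_Y(X)=N(X)\cap Y$, $N_Y(x)=N_Y(\{x\})$, $N_Y(x,y)=N_Y(\{x,y\})$, $N_S[v]=(N(v)\cup\{v\})\cap S$. A structured pair is $(G,(A,B,S))$ with $A,B,S$ nonempty partitioning $V(G)$, $G[A]$, $G[B]$ connected, $N(A)=N(B)=S$, and for some $\varepsilon>0$, $|N_S[v]|\leq\varepsilon|S|$ for all $v$. It is nice if: (NE1) for every $x\in S$, $A\not\subseteq N(x)$ and $B\not\subseteq N(x)$; (NE2) for all distinct nonadjacent $x,y\in S$, if $N_B(x)\neq N_B(y)$ then there is no edge between $N_A(x)\cap N_A(y)$ and $A\setminus N_A(x,y)$, and the same with $A,B$ swapped; (NE3) for all distinct nonadjacent $x,y\in S$ with $N_A(x)\subsetneq N_A(y)$, every vertex of $N_A(x)$ is adjacent to every vertex of $N_A(y)\setminus N_A(x)$, and the same with $A,B$ swapped; (E1) for all adjacent $x,y\in S$, either $N_A(x)\setminus N_A(y)=\emptyset$ or $N_B(x)\setminus N_B(y)=\emptyset$. -}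

module Defs where

open import Data.Nat using (ℕ; zero; suc; _+_)
open import Data.Bool using (Bool; true; false; _∨_; _∧_; if_then_else_)
open import Data.Fin using (Fin; _≟_)
open import Data.List using (List; map)
open import Data.Nat.ListAction using (sum)
open import Data.Fin.Base using ()
open import Data.List.Base using ()
open import Data.Product using (Σ; ∃; _×_; _,_)
open import Data.Sum using (_⊎_)
open import Data.Integer using (+_)
open import Data.Rational using (ℚ; _/_; _*_; _≤_; Positive)
open import Relation.Nullary using (¬_; does)
open import Relation.Binary.PropositionalEquality using (_≡_; _≢_)
import Data.List as L
import Data.Fin as F

record Graph (n : ℕ) : Set where
  field
    adj     : Fin n → Fin n → Bool
    adj-sym : ∀ u v → adj u v ≡ adj v u
    adj-irr : ∀ v → adj v v ≡ false

open Graph public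

E : ∀ {n} → Graph n → Fin n → Fin n → Set
E G u v = adj G u v ≡ true

data Part : Set where
  inA inB inS : Part

isS : Part → Bool
isS inS = true
isS _   = false

Partition : ℕ → Set
Partition n = Fin n → Part

count : ∀ {n} → (Fin n → Bool) → ℕ
count {n} p = sum (map (λ v → if p v then 1 else 0) (L.allFin n))

sizeS : ∀ {n} → Partition n → ℕ
sizeS P = count (λ v → isS (P v))

closedNbhdS : ∀ {n} → Graph n → Partition n → Fin n → ℕ
closedNbhdS G P v = count (λ u → isS (P u) ∧ (does (u ≟ v) ∨ adj G v u))

-- Walks inside the vertex set X = {v | P v ≡ X}: Reach G P X u v means there is
-- a path from u to v all of whose vertices lie in X (u is assumed in X).
data Reach {n} (G : Graph n) (P : Partition n) (X : Part) : Fin n → Fin n → Set where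
  here : ∀ {u} → Reach G P X u u
  step : ∀ {u w v} → E G u w → P w ≡ X → Reach G P X w v → Reach G P X u v

ConnectedPart : ∀ {n} → Graph n → Partition n → Part → Set
ConnectedPart G P X = ∀ u v → P u ≡ X → P v ≡ X → Reach G P X u v

NbhdIs : ∀ {n} → Graph n → Partition n → Part → Part → Set
NbhdIs G P X Y = ∀ v → ((P v ≢ X × ∃ λ u → P u ≡ X × E G v u) → P v ≡ Y)
                     × (P v ≡ Y → (P v ≢ X × ∃ λ u → P u ≡ X × E G v u))

NonEmptyPart : ∀ {n} → Partition n → Part → Set
NonEmptyPart P X = ∃ λ v → P v ≡ X

toℚ : ℕ → ℚ
toℚ k = (+ k) / 1

StructuredPair : ∀ {n} → Graph n → Partition n → ℚ → Set
StructuredPair G P ε =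
  NonEmptyPart P inA × NonEmptyPart P inB × NonEmptyPart P inS
  × ConnectedPart G P inA × ConnectedPart G P inB
  × NbhdIs G P inA inS × NbhdIs G P inB inS
  × Positive ε
  × (∀ v → toℚ (closedNbhdS G P v) ≤ ε * toℚ (sizeS P))

NSub : ∀ {n} → Graph n → Partition n → Part → Fin n → Fin n → Set
NSub G P X x y = ∀ a → P a ≡ X → E G x a → E G y a

NSSub : ∀ {n} → Graph n → Partition n → Part → Fin n → Fin n → Set
NSSub G P X x y = NSub G P X x y × ¬ NSub G P X y x

NEq : ∀ {n} → Graph n → Partition n → Part → Fin n → Fin n → Set
NEq G P X x y = NSub G P X x y × NSub G P X y x

NE1 : ∀ {n} → Graph n → Partition n → Part → Set
NE1 G P X = ∀ x → P x ≡ inS → ¬ (∀ a → P a ≡ X → E G x a)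

NE2 : ∀ {n} → Graph n → Partition n → Part → Part → Set
NE2 G P X Y = ∀ x y → P x ≡ inS → P y ≡ inS → x ≢ y → ¬ E G x y →
  ¬ NEq G P Y x y →
  ∀ a a' → P a ≡ X → E G x a → E G y a →
           P a' ≡ X → ¬ E G x a' → ¬ E G y a' → ¬ E G a a'

NE3 : ∀ {n} → Graph n → Partition n → Part → Set
NE3 G P X = ∀ x y → P x ≡ inS → P y ≡ inS → x ≢ y → ¬ E G x y →
  NSSub G P X x y →
  ∀ a a' → P a ≡ X → E G x a → P a' ≡ X → E G y a' → ¬ E G x a' → E G a a'

E1 : ∀ {n} → Graph n → Partition n → Set
E1 G P = ∀ x y → P x ≡ inS → P y ≡ inS → E G x y →
  NSub G P inA x y ⊎ NSub G P inB x y

Nice : ∀ {n} → Graph n → Partition n → Set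
Nice G P = NE1 G P inA × NE1 G P inB
         × NE2 G P inA inB × NE2 G P inB inA
         × NE3 G P inA × NE3 G P inB
         × E1 G P

BadChain : ∀ {n} → Graph n → Partition n → Part → Set
BadChain {n} G P X = Σ (Fin n) λ x → Σ (Fin n) λ y → Σ (Fin n) λ z →
  P x ≡ inS × P y ≡ inS × P z ≡ inS
  × x ≢ y × y ≢ z × x ≢ z
  × ¬ E G x y × ¬ E G y z
  × NSSub G P X x y × NSSub G P X y z

-- Take a ∈ N_X(x) and c ∈ N_X(z) ∖ N_X(y). By (NE3) for y, z the vertex a, which lies
-- in N_X(y), is adjacent to c, giving an edge between N_X(x) ∩ N_X(y) and
-- X ∖ N_X(x, y); so (NE2) forces N_Y(x) = N_Y(y). But then (NE2) with the roles of X
-- and Y exchanged says no edge of G[Y] leaves N_Y(x), which is nonempty because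
-- N(Y) = S and is not all of Y by (NE1), contradicting the connectivity of G[Y].
module Submission where

open import Defs
open import Data.Rational using (ℚ)
open import Data.Product using (_×_; _,_; proj₂; ∃)
open import Data.Bool using (true)
import Data.Bool.Properties as Bool
open import Data.Fin using (Fin)
open import Data.Fin.Properties using (¬∀⟶∃¬)
open import Data.Empty using (⊥-elim)
open import Relation.Nullary using (¬_; Dec; yes; no)
open import Relation.Nullary.Decidable using (_→-dec_)
open import Relation.Binary.PropositionalEquality using (_≡_; refl; _≢_)

_≟ᴾ_ : (p q : Part) → Dec (p ≡ q)
inA ≟ᴾ inA = yes refl
inA ≟ᴾ inB = no λ ()
inA ≟ᴾ inS = no λ ()
inB ≟ᴾ inA = no λ ()
inB ≟ᴾ inB = yes refl
inB ≟ᴾ inS = no λ ()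
inS ≟ᴾ inA = no λ ()
inS ≟ᴾ inB = no λ ()
inS ≟ᴾ inS = yes refl

E? : ∀ {n} (G : Graph n) u v → Dec (E G u v)
E? G u v = adj G u v Bool.≟ true

¬→⇒×¬ : ∀ {A B : Set} → Dec A → ¬ (A → B) → A × ¬ B
¬→⇒×¬ (yes a) ¬a→b = a , λ b → ¬a→b λ _ → b
¬→⇒×¬ (no ¬a) ¬a→b = ⊥-elim (¬a→b λ a → ⊥-elim (¬a a))

module _ {n} (G : Graph n) (P : Partition n) (X : Part) where

  ¬NSub⇒witness : ∀ {x y} → ¬ NSub G P X x y → ∃ λ c → P c ≡ X × E G x c × ¬ E G y c
  ¬NSub⇒witness {x} {y} ¬sub
    with c , ¬Pc⇒ ← ¬∀⟶∃¬ n _ (λ c → (P c ≟ᴾ X) →-dec (E? G x c →-dec E? G y c)) ¬sub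
    with Pc , ¬xc⇒yc ← ¬→⇒×¬ (P c ≟ᴾ X) ¬Pc⇒
    with xc , ¬yc ← ¬→⇒×¬ (E? G x c) ¬xc⇒yc
    = c , Pc , xc , ¬yc

  ¬covers⇒witness : ∀ {x} → ¬ (∀ a → P a ≡ X → E G x a) → ∃ λ d → P d ≡ X × ¬ E G x d
  ¬covers⇒witness {x} ¬covers
    with d , ¬Pd⇒ ← ¬∀⟶∃¬ n _ (λ d → (P d ≟ᴾ X) →-dec E? G x d) ¬covers
    = d , ¬→⇒×¬ (P d ≟ᴾ X) ¬Pd⇒

  NeighbourhoodClosed : Fin n → Set
  NeighbourhoodClosed x =
    ∀ a a' → P a ≡ X → E G x a → P a' ≡ X → ¬ E G x a' → ¬ E G a a'

  Reach-neighbourhood : ∀ {x u v} → NeighbourhoodClosed x →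
    Reach G P X u v → P u ≡ X → E G x u → E G x v
  Reach-neighbourhood closed here Pu xu = xu
  Reach-neighbourhood {x} closed (step {u} {w} uw Pw w⇝v) Pu xu with E? G x w
  ... | yes xw = Reach-neighbourhood closed w⇝v Pw xw
  ... | no ¬xw = ⊥-elim (closed u w Pu xu Pw ¬xw uw)

  connected⇒¬NeighbourhoodClosed : ConnectedPart G P X → NbhdIs G P X inS → NE1 G P X →
    ∀ {x} → P x ≡ inS → ¬ NeighbourhoodClosed x
  connected⇒¬NeighbourhoodClosed connected N≡S ne1 {x} Px closed
    with _ , u , Pu , xu ← proj₂ (N≡S x) Px
    with d , Pd , ¬xd ← ¬covers⇒witness (ne1 x Px)
    = ¬xd (Reach-neighbourhood closed (connected u d Pu Pd) Pu xu)

module _ {n} (G : Graph n) (P : Partition n) (X Y : Part) where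

  sameNeighbours⇒NeighbourhoodClosed : NE2 G P Y X →
    ∀ {x y} → P x ≡ inS → P y ≡ inS → x ≢ y → ¬ E G x y →
    ¬ NEq G P X x y → NEq G P Y x y → NeighbourhoodClosed G P Y x
  sameNeighbours⇒NeighbourhoodClosed ne2 Px Py x≢y ¬xy ¬sameX (x⊆y , y⊆x) a a' Pa xa Pa' ¬xa' =
    ne2 _ _ Px Py x≢y ¬xy ¬sameX a a' Pa xa (x⊆y a Pa xa) Pa' ¬xa' λ ya' → ¬xa' (y⊆x a' Pa' ya')

  distinctNeighbours : ConnectedPart G P Y → NbhdIs G P Y inS → NE1 G P Y → NE2 G P Y X →
    ∀ {x y} → P x ≡ inS → P y ≡ inS → x ≢ y → ¬ E G x y →
    ¬ NEq G P X x y → ¬ NEq G P Y x y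
  distinctNeighbours connected N≡S ne1 ne2 Px Py x≢y ¬xy ¬sameX differentY =
    connected⇒¬NeighbourhoodClosed G P Y connected N≡S ne1 Px
      (sameNeighbours⇒NeighbourhoodClosed ne2 Px Py x≢y ¬xy ¬sameX differentY)

strictSuperset⇒joinedWitness : ∀ {n} (G : Graph n) (P : Partition n) (X : Part) → NE3 G P X →
  ∀ {y z} → P y ≡ inS → P z ≡ inS → y ≢ z → ¬ E G y z → NSSub G P X y z →
  ∃ λ c → P c ≡ X × E G z c × ¬ E G y c × (∀ a → P a ≡ X → E G y a → E G a c)
strictSuperset⇒joinedWitness G P X ne3 Py Pz y≢z ¬yz y⊊z@(_ , z⊈y)
  with c , Pc , zc , ¬yc ← ¬NSub⇒witness G P X z⊈y
  = c , Pc , zc , ¬yc , λ a Pa ya → ne3 _ _ Py Pz y≢z ¬yz y⊊z a c Pa ya Pc zc ¬yc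

¬BadChain : ∀ {n} (G : Graph n) (P : Partition n) (X Y : Part) →
  NbhdIs G P X inS → NbhdIs G P Y inS → ConnectedPart G P Y →
  NE1 G P Y → NE2 G P X Y → NE2 G P Y X → NE3 G P X → ¬ BadChain G P X
¬BadChain G P X Y N[X]≡S N[Y]≡S connected ne1 ne2XY ne2YX ne3
  (x , y , z , Px , Py , Pz , x≢y , y≢z , _ , ¬xy , ¬yz , (x⊆y , y⊈x) , y⊊z)
  with _ , a , Pa , xa ← proj₂ (N[X]≡S x) Px
  with c , Pc , _ , ¬yc , joined ← strictSuperset⇒joinedWitness G P X ne3 Py Pz y≢z ¬yz y⊊z
  = ne2XY x y Px Py x≢y ¬xy differentY a c Pa xa ya Pc (λ xc → ¬yc (x⊆y c Pc xc)) ¬yc (joined a Pa ya)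
  where
  ya = x⊆y a Pa xa
  differentY : ¬ NEq G P Y x y
  differentY = distinctNeighbours G P X Y connected N[Y]≡S ne1 ne2YX Px Py x≢y ¬xy λ (_ , y⊆x) → y⊈x y⊆x

lemma5p3 : ∀ {n} (G : Graph n) (P : Partition n) (ε : ℚ) →
    StructuredPair G P ε → Nice G P →
    ¬ BadChain G P inA × ¬ BadChain G P inB
lemma5p3 G P ε (_ , _ , _ , connectedA , connectedB , N[A]≡S , N[B]≡S , _)
               (ne1A , ne1B , ne2AB , ne2BA , ne3A , ne3B , _) =
  ¬BadChain G P inA inB N[A]≡S N[B]≡S connectedB ne1B ne2AB ne2BA ne3A ,
  ¬BadChain G P inB inA N[B]≡S N[A]≡S connectedA ne1A ne2BA ne2AB ne3B
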